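{- Let $S_n=K_{n-1,1}$ be the star graph on $n\ge 2$ vertices. Then $$A(S_n;x)=\sum_{k=0}^{\lfloor (n-1)/2\rfloor}\binom{n-1}{k}x^{2k+1}+(n-1)x^{n-1}+x^{n+1}\sum_{k=\lceil n/2\rceil}^{n-1}\binom{n-1}{k}.$$
   Context: For a finite simple graph $\Gamma=(V,E)$ of order $n$, a vertex $v$ and $X\subseteq V$, $\delta_X(v)$ is the number of neighbours of $v$ in $X$, $\delta_1$ the maximum degree, $\bar S=V\setminus S$, and $\mathcal{K}=[-\delta_1,\delta_1]\cap\mathbb{Z}$. A nonempty $S\subseteq V$ is a defensive $k$-alliance if $\delta_S(v)\ge\delta_{\bar S}(v)+k$ for all $v\in S$; its exact index of alliance is $k_S=\max\{k\in\mathcal{K}: S \text{ is a defensive } k\text{ -alliance}\}$. The alliance polynomial is $A(\Gamma;x)=\sum_{S} x^{n+k_S}$, the sum over all nonempty $S\subseteq V$ with induced subgraph $\langle S\rangle$ connected. -}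

module Defs where

open import Data.Bool using (Bool; true; false; _∧_; _∨_; not; if_then_else_; _xor_)
open import Data.Nat as ℕ using (ℕ; zero; suc; _⊔_)
open import Data.Integer as ℤ using (ℤ; +_; -_)
open import Data.Fin using (Fin; zero; suc)
open import Data.Vec as Vec using (Vec; []; _∷_; lookup; tabulate)
open import Data.List using (List; []; _∷_; _++_; map; foldr; foldl; allFin; upTo)
open import Relation.Nullary.Decidable using (⌊_⌋)
open import Relation.Binary.PropositionalEquality using (_≡_; refl)

record SimpleGraph : Set where
  field
    order      : ℕ
    adj        : Fin order → Fin order → Bool
    adj-sym    : ∀ u v → adj u v ≡ adj v u
    adj-irrefl : ∀ v → adj v v ≡ false

-- vertex subsets as characteristic vectors
VSet : ℕ → Set
VSet n = Vec Bool n

allSubsets : (n : ℕ) → List (VSet n)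
allSubsets zero    = [] ∷ []
allSubsets (suc n) = map (true ∷_) (allSubsets n) ++ map (false ∷_) (allSubsets n)

count : {A : Set} → (A → Bool) → List A → ℕ
count p []       = 0
count p (x ∷ xs) = if p x then suc (count p xs) else count p xs

allL anyL : {A : Set} → (A → Bool) → List A → Bool
allL p = foldr (λ x b → p x ∧ b) true
anyL p = foldr (λ x b → p x ∨ b) false

iter : {A : Set} → ℕ → (A → A) → A → A
iter zero    f a = a
iter (suc k) f a = f (iter k f a)

module _ (Γ : SimpleGraph) where
  open SimpleGraph Γ

  V : List (Fin order)
  V = allFin order

  δ : VSet order → Fin order → ℕ
  δ X v = count (λ u → lookup X u ∧ adj v u) V

  degree : Fin order → ℕ
  degree v = count (adj v) V

  maxDegree : ℕ
  maxDegree = foldr _⊔_ 0 (map degree V)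

  compl : VSet order → VSet order
  compl S = Vec.map not S

  isDefAlliance : VSet order → ℤ → Bool
  isDefAlliance S k =
    allL (λ v → not (lookup S v) ∨ ⌊ (+ δ (compl S) v) ℤ.+ k ℤ.≤? (+ δ S v) ⌋) V

  𝒦 : List ℤ
  𝒦 = map (λ i → (+ i) ℤ.- (+ maxDegree)) (upTo (suc (2 ℕ.* maxDegree)))

  -- exact index of alliance k_S = max{k ∈ 𝒦 : S is a defensive k-alliance}
  -- (scan 𝒦 increasingly, keep the last k that works; -δ₁ always works, so
  --  the default value -δ₁ is never returned spuriously)
  exactIndex : VSet order → ℤ
  exactIndex S = foldl (λ best k → if isDefAlliance S k then k else best)
                       (- (+ maxDegree)) 𝒦

  nonempty : VSet order → Bool
  nonempty S = anyL (lookup S) V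

  -- vertices reachable from v by a walk inside ⟨S⟩ (closure after `order` steps)
  reachFrom : VSet order → Fin order → VSet order
  reachFrom S v = iter order step (tabulate (λ u → ⌊ u Data.Fin.≟ v ⌋))
    where
    step : VSet order → VSet order
    step R = tabulate (λ u → lookup R u ∨
                         (lookup S u ∧ anyL (λ w → lookup R w ∧ adj w u) V))

  connected : VSet order → Bool
  connected S = allL (λ v → not (lookup S v) ∨
                  allL (λ u → not (lookup S u) ∨ lookup (reachFrom S v) u) V) V

-- Polynomials with ℕ coefficients, as coefficient functions
-- (p m = coefficient of x^m)

Poly : Set
Poly = ℕ → ℕ

infix 4 _≈ₚ_
_≈ₚ_ : Poly → Poly → Set
p ≈ₚ q = ∀ m → p m ≡ q m

infixl 6 _⊕_
_⊕_ : Poly → Poly → Poly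
(p ⊕ q) m = p m ℕ.+ q m

infix 7 _·x^_
_·x^_ : ℕ → ℕ → Poly
(c ·x^ e) m = if ⌊ m ℕ.≟ e ⌋ then c else 0

zeroP : Poly
zeroP _ = 0

-- Σ_{k=a}^{b} f k  (empty if b < a)
ΣP[_to_] : ℕ → ℕ → (ℕ → Poly) → Poly
ΣP[ a to b ] f = foldr (λ i p → f (a ℕ.+ i) ⊕ p) zeroP (upTo (suc b ℕ.∸ a))

Σ[_to_] : ℕ → ℕ → (ℕ → ℕ) → ℕ
Σ[ a to b ] f = foldr (λ i s → f (a ℕ.+ i) ℕ.+ s) 0 (upTo (suc b ℕ.∸ a))

A : SimpleGraph → Poly
A Γ m = count (λ S → nonempty Γ S ∧ connected Γ S ∧
                     ⌊ (+ m) ℤ.≟ (+ order) ℤ.+ exactIndex Γ S ⌋)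
              (allSubsets order)
  where open SimpleGraph Γ

-- Star graph S_n = K_{n-1,1}: vertex 0 is the centre, all others leaves

isCentre : {n : ℕ} → Fin n → Bool
isCentre zero    = true
isCentre (suc _) = false

star : ℕ → SimpleGraph
star n = record
  { order      = n
  ; adj        = λ u v → isCentre u xor isCentre v
  ; adj-sym    = λ u v → xor-comm (isCentre u) (isCentre v)
  ; adj-irrefl = λ v → xor-self (isCentre v)
  }
  where
  xor-comm : ∀ a b → a xor b ≡ b xor a
  xor-comm true  true  = refl
  xor-comm true  false = refl
  xor-comm false true  = refl
  xor-comm false false = refl
  xor-self : ∀ a → a xor a ≡ false
  xor-self true  = refl
  xor-self false = refl

module Submission where

-- A nonempty vertex set S is described by whether it contains the centre and by
-- the vector X of leaves it contains; let j be the number of leaves in S.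
--  * Centre in S: the centre has j neighbours inside and p - j outside, every leaf
--    of S has its single neighbour inside, so S is a defensive k-alliance iff
--    k ≤ 2j - p and (j = 0 or k ≤ 1).  Hence n + k_S = 1 + min(2j, p + 1), and
--    ⟨S⟩ is always connected.
--  * Centre not in S: ⟨S⟩ is connected iff S is a single leaf, and then k_S = -1,
--    contributing x^{n-1} = x^p, p times.
-- Counting the subsets of the leaves by size then gives
--   A(S_n; x) = Σ_j C(p,j) x^{1 + min(2j, p+1)} + p x^p,
-- and splitting the sum at j = ⌊p/2⌋ yields the stated formula.

open import Defs
open import Data.Bool using (Bool; true; false; _∧_; _∨_; not; if_then_else_)
open import Data.Bool.Properties using (∧-identityʳ; ∧-zeroʳ; ∨-identityʳ; ∨-zeroʳ)
open import Data.Empty using (⊥-elim)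
open import Data.Fin as Fin using (Fin; zero; suc)
import Data.Fin.Properties as FinP
open import Data.Integer as ℤ using (ℤ; +_; -_)
import Data.Integer.Properties as ℤP
open import Data.List as List using (List; []; _∷_; _++_; foldr; foldl; allFin; upTo; applyUpTo)
import Data.List.Properties as ListP
open import Data.Nat using (ℕ; zero; suc; _≤_; _<_; _+_; _*_; _∸_; _/_; _%_; _⊓_; _⊔_; z≤n; s≤s; _≤?_; _≟_)
import Data.Nat.Properties as ℕP
open import Data.Nat.Combinatorics using (_C_; nCk+nC[k+1]≡[n+1]C[k+1]; k>n⇒nCk≡0; nC1≡n)
import Data.Nat.DivMod as DivMod
import Data.Nat.Tactic.RingSolver as ℕSolver
import Data.Integer.Tactic.RingSolver as ℤSolver
open import Data.Vec as Vec using (Vec; []; _∷_; lookup)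
import Data.Vec.Properties as VecP
open import Function using (_∘_)
open import Function.Bundles using (mk⇔)
open import Relation.Nullary using (Dec; yes; no)
open import Relation.Nullary.Decidable using (⌊_⌋; isYes≗does; does-⇔; dec-true)
open import Relation.Binary.PropositionalEquality

⌊⌋-⇔ : ∀ {P Q : Set} (p? : Dec P) (q? : Dec Q) → (P → Q) → (Q → P) → ⌊ p? ⌋ ≡ ⌊ q? ⌋
⌊⌋-⇔ p? q? to from =
  trans (isYes≗does p?) (trans (does-⇔ (mk⇔ to from) p? q?) (sym (isYes≗does q?)))

count-++ : ∀ {A : Set} (q : A → Bool) xs ys → count q (xs ++ ys) ≡ count q xs + count q ys
count-++ q [] ys = refl
count-++ q (x ∷ xs) ys with q x
... | true = cong suc (count-++ q xs ys)
... | false = count-++ q xs ys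

count-map : ∀ {A B : Set} (q : B → Bool) (f : A → B) xs → count q (List.map f xs) ≡ count (q ∘ f) xs
count-map q f [] = refl
count-map q f (x ∷ xs) with q (f x)
... | true = cong suc (count-map q f xs)
... | false = count-map q f xs

count-cong : ∀ {A : Set} {q r : A → Bool} → (∀ x → q x ≡ r x) → ∀ xs → count q xs ≡ count r xs
count-cong h [] = refl
count-cong {r = r} h (x ∷ xs) rewrite h x with r x
... | true = cong suc (count-cong h xs)
... | false = count-cong h xs

-- count / all / any over a tabulated list only see the values q (f i); these let
-- us re-index the vertex list Fin (suc p) = zero ∷ map suc (Fin p) of the star.
count-tabulate : ∀ {A B : Set} n (f : Fin n → A) (g : Fin n → B) (q : A → Bool) (r : B → Bool) →
  (∀ i → q (f i) ≡ r (g i)) → count q (List.tabulate f) ≡ count r (List.tabulate g)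
count-tabulate zero f g q r h = refl
count-tabulate (suc n) f g q r h rewrite h zero with r (g zero)
... | true = cong suc (count-tabulate n (f ∘ suc) (g ∘ suc) q r (h ∘ suc))
... | false = count-tabulate n (f ∘ suc) (g ∘ suc) q r (h ∘ suc)

allL-tabulate : ∀ {A B : Set} n (f : Fin n → A) (g : Fin n → B) (q : A → Bool) (r : B → Bool) →
  (∀ i → q (f i) ≡ r (g i)) → allL q (List.tabulate f) ≡ allL r (List.tabulate g)
allL-tabulate zero f g q r h = refl
allL-tabulate (suc n) f g q r h = cong₂ _∧_ (h zero) (allL-tabulate n (f ∘ suc) (g ∘ suc) q r (h ∘ suc))

anyL-tabulate : ∀ {A B : Set} n (f : Fin n → A) (g : Fin n → B) (q : A → Bool) (r : B → Bool) →
  (∀ i → q (f i) ≡ r (g i)) → anyL q (List.tabulate f) ≡ anyL r (List.tabulate g)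
anyL-tabulate zero f g q r h = refl
anyL-tabulate (suc n) f g q r h = cong₂ _∨_ (h zero) (anyL-tabulate n (f ∘ suc) (g ∘ suc) q r (h ∘ suc))

count-tabulate-true : ∀ {A : Set} n (f : Fin n → A) (q : A → Bool) → (∀ i → q (f i) ≡ true) →
  count q (List.tabulate f) ≡ n
count-tabulate-true zero f q h = refl
count-tabulate-true (suc n) f q h rewrite h zero = cong suc (count-tabulate-true n (f ∘ suc) q (h ∘ suc))

count-tabulate-false : ∀ {A : Set} n (f : Fin n → A) (q : A → Bool) → (∀ i → q (f i) ≡ false) →
  count q (List.tabulate f) ≡ 0
count-tabulate-false zero f q h = refl
count-tabulate-false (suc n) f q h rewrite h zero = count-tabulate-false n (f ∘ suc) q (h ∘ suc)

anyL-tabulate-false : ∀ {A : Set} n (f : Fin n → A) (q : A → Bool) → (∀ i → q (f i) ≡ false) →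
  anyL q (List.tabulate f) ≡ false
anyL-tabulate-false zero f q h = refl
anyL-tabulate-false (suc n) f q h rewrite h zero = anyL-tabulate-false n (f ∘ suc) q (h ∘ suc)

anyL-tabulate-witness : ∀ {A : Set} n (f : Fin n → A) (q : A → Bool) i → q (f i) ≡ true →
  anyL q (List.tabulate f) ≡ true
anyL-tabulate-witness (suc n) f q zero h rewrite h = refl
anyL-tabulate-witness (suc n) f q (suc i) h rewrite anyL-tabulate-witness n (f ∘ suc) q i h = ∨-zeroʳ (q (f zero))

allL-true : ∀ {A : Set} (q : A → Bool) → (∀ x → q x ≡ true) → ∀ xs → allL q xs ≡ true
allL-true q h [] = refl
allL-true q h (x ∷ xs) rewrite h x = allL-true q h xs

iter-suc : ∀ {A : Set} k (f : A → A) a → iter (suc k) f a ≡ iter k f (f a)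
iter-suc zero f a = refl
iter-suc (suc k) f a = cong f (iter-suc k f a)

iter-fixed : ∀ {A : Set} k (f : A → A) b → f b ≡ b → iter k f b ≡ b
iter-fixed zero f b h = refl
iter-fixed (suc k) f b h = trans (cong f (iter-fixed k f b h)) h

lookup-ext : ∀ {n} {A : Set} (u w : Vec A n) → (∀ i → lookup u i ≡ lookup w i) → u ≡ w
lookup-ext u w h = trans (sym (VecP.tabulate∘lookup u)) (trans (VecP.tabulate-cong h) (VecP.tabulate∘lookup w))

trues : ∀ {p} → Vec Bool p → ℕ
trues [] = 0
trues (b ∷ X) = if b then suc (trues X) else trues X

positive : ℕ → Bool
positive zero = false
positive (suc _) = true

count-lookup : ∀ {p} (X : Vec Bool p) → count (lookup X) (allFin p) ≡ trues X
count-lookup [] = refl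
count-lookup {suc p} (true ∷ X) =
  cong suc (trans (count-tabulate p suc (λ i → i) (lookup (true ∷ X)) (lookup X) (λ i → refl)) (count-lookup X))
count-lookup {suc p} (false ∷ X) =
  trans (count-tabulate p suc (λ i → i) (lookup (false ∷ X)) (lookup X) (λ i → refl)) (count-lookup X)

anyL-lookup : ∀ {p} (X : Vec Bool p) → anyL (lookup X) (allFin p) ≡ positive (trues X)
anyL-lookup [] = refl
anyL-lookup {suc p} (true ∷ X) = refl
anyL-lookup {suc p} (false ∷ X) =
  trans (anyL-tabulate p suc (λ i → i) (lookup (false ∷ X)) (lookup X) (λ i → refl)) (anyL-lookup X)

allL-members : ∀ {p} (X : Vec Bool p) (B : Bool) →
  allL (λ i → not (lookup X i) ∨ B) (allFin p) ≡ not (positive (trues X)) ∨ B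
allL-members [] B = refl
allL-members {suc p} (true ∷ X) B =
  trans (cong (B ∧_) (trans (allL-tabulate p suc (λ i → i) _ (λ i → not (lookup X i) ∨ B) (λ i → refl))
                            (allL-members X B)))
        (absorb B (not (positive (trues X))))
  where
  absorb : ∀ B x → B ∧ (x ∨ B) ≡ B
  absorb true x = ∨-zeroʳ x
  absorb false x = refl
allL-members {suc p} (false ∷ X) B =
  trans (allL-tabulate p suc (λ i → i) _ (λ i → not (lookup X i) ∨ B) (λ i → refl)) (allL-members X B)

trues-compl : ∀ {p} (X : Vec Bool p) → trues (Vec.map not X) + trues X ≡ p
trues-compl [] = refl
trues-compl {suc p} (true ∷ X) = trans (ℕP.+-suc _ _) (cong suc (trues-compl X))
trues-compl {suc p} (false ∷ X) = cong suc (trues-compl X)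

module ThresholdScan (P : ℤ → Bool) (D c : ℕ) (threshold : ∀ i → P (+ i ℤ.- + D) ≡ ⌊ i ≤? c ⌋) where

  shift : ℕ → ℤ
  shift i = + i ℤ.- + D

  keepLast : ℤ → ℤ → ℤ
  keepLast best k = if P k then k else best

  scan : ∀ m → foldl keepLast (- + D) (List.map shift (upTo (suc m))) ≡ shift (m ⊓ c)
  scan zero rewrite threshold 0 = refl
  scan (suc m) = begin
      foldl keepLast (- + D) (List.map shift (upTo (suc (suc m))))
    ≡⟨ cong (λ xs → foldl keepLast (- + D) (List.map shift xs)) (sym (ListP.upTo-∷ʳ (suc m))) ⟩
      foldl keepLast (- + D) (List.map shift (upTo (suc m) List.∷ʳ suc m))
    ≡⟨ cong (foldl keepLast (- + D)) (ListP.map-++ shift (upTo (suc m)) (suc m ∷ [])) ⟩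
      foldl keepLast (- + D) (List.map shift (upTo (suc m)) List.∷ʳ shift (suc m))
    ≡⟨ ListP.foldl-∷ʳ keepLast (- + D) (shift (suc m)) (List.map shift (upTo (suc m))) ⟩
      keepLast (foldl keepLast (- + D) (List.map shift (upTo (suc m)))) (shift (suc m))
    ≡⟨ cong (λ z → keepLast z (shift (suc m))) (scan m) ⟩
      keepLast (shift (m ⊓ c)) (shift (suc m))
    ≡⟨ last-step ⟩
      shift (suc m ⊓ c) ∎
    where
    open ≡-Reasoning
    last-step : keepLast (shift (m ⊓ c)) (shift (suc m)) ≡ shift (suc m ⊓ c)
    last-step rewrite threshold (suc m) with suc m ≤? c
    ... | yes 1+m≤c = cong shift (sym (ℕP.m≤n⇒m⊓n≡m 1+m≤c))
    ... | no 1+m≰c = cong shift (trans (ℕP.m≥n⇒m⊓n≡n c≤m) (sym (ℕP.m≥n⇒m⊓n≡n (ℕP.m≤n⇒m≤1+n c≤m))))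
      where c≤m = ℕP.≤-pred (ℕP.≰⇒> 1+m≰c)

exactIndex-threshold : ∀ Γ S D c → maxDegree Γ ≡ D → c ≤ 2 * D →
  (∀ i → isDefAlliance Γ S (+ i ℤ.- + D) ≡ ⌊ i ≤? c ⌋) → exactIndex Γ S ≡ + c ℤ.- + D
exactIndex-threshold Γ S D c refl c≤2D threshold =
  trans (scan (2 * D)) (cong shift (ℕP.m≥n⇒m⊓n≡n c≤2D))
  where open ThresholdScan (isDefAlliance Γ S) D c threshold

-- The star with p leaves: vertex 0 is the centre, vertex suc i is leaf i.
Star : ℕ → SimpleGraph
Star p = star (suc p)

δ-centre : ∀ p b (X : Vec Bool p) → δ (Star p) (b ∷ X) zero ≡ trues X
δ-centre p true X = trans (count-tabulate p suc (λ i → i) _ (lookup X) (λ i → ∧-identityʳ _)) (count-lookup X)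
δ-centre p false X = trans (count-tabulate p suc (λ i → i) _ (lookup X) (λ i → ∧-identityʳ _)) (count-lookup X)

δ-leaf : ∀ p b (X : Vec Bool p) i → δ (Star p) (b ∷ X) (suc i) ≡ (if b then 1 else 0)
δ-leaf p true X i = cong suc (count-tabulate-false p suc _ (λ u → ∧-zeroʳ _))
δ-leaf p false X i = count-tabulate-false p suc _ (λ u → ∧-zeroʳ _)

maxDegree-Star : ∀ p → 1 ≤ p → maxDegree (Star p) ≡ p
maxDegree-Star p 1≤p =
  trans (cong (_⊔ foldr _⊔_ 0 (List.map (degree (Star p)) (List.tabulate {n = p} suc))) degree-centre)
        (ℕP.m≥n⇒m⊔n≡m (ℕP.≤-trans (leaves-≤1 p suc (λ i → ℕP.≤-reflexive (degree-leaf i))) 1≤p))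
  where
  degree-centre : degree (Star p) zero ≡ p
  degree-centre = count-tabulate-true p suc _ (λ i → refl)
  degree-leaf : ∀ i → degree (Star p) (suc i) ≡ 1
  degree-leaf i = cong suc (count-tabulate-false p suc _ (λ u → refl))
  leaves-≤1 : ∀ n (f : Fin n → Fin (suc p)) → (∀ i → degree (Star p) (f i) ≤ 1) →
    foldr _⊔_ 0 (List.map (degree (Star p)) (List.tabulate f)) ≤ 1
  leaves-≤1 zero f h = z≤n
  leaves-≤1 (suc n) f h = ℕP.⊔-lub (h zero) (leaves-≤1 n (f ∘ suc) (h ∘ suc))

shifted-≤ : ∀ a i b c → ⌊ (+ a) ℤ.+ ((+ i) ℤ.- (+ b)) ℤ.≤? + c ⌋ ≡ ⌊ a + i ≤? c + b ⌋
shifted-≤ a i b c = ⌊⌋-⇔ _ _ to from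
  where
  add-back : ∀ (A I B : ℤ) → (A ℤ.+ (I ℤ.- B)) ℤ.+ B ≡ A ℤ.+ I
  add-back = ℤSolver.solve-∀
  regroup : ∀ (A I B : ℤ) → (A ℤ.+ I) ℤ.- B ≡ A ℤ.+ (I ℤ.- B)
  regroup = ℤSolver.solve-∀
  cancel : ∀ (X B : ℤ) → (X ℤ.+ B) ℤ.- B ≡ X
  cancel = ℤSolver.solve-∀
  to : (+ a) ℤ.+ ((+ i) ℤ.- (+ b)) ℤ.≤ + c → a + i ≤ c + b
  to H = ℤP.drop‿+≤+ (subst (ℤ._≤ (+ c) ℤ.+ (+ b)) (add-back (+ a) (+ i) (+ b)) (ℤP.+-monoˡ-≤ (+ b) H))
  from : a + i ≤ c + b → (+ a) ℤ.+ ((+ i) ℤ.- (+ b)) ℤ.≤ + c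
  from H = subst₂ ℤ._≤_ (regroup (+ a) (+ i) (+ b)) (cancel (+ c) (+ b)) (ℤP.+-monoˡ-≤ (ℤ.- (+ b)) (ℤ.+≤+ H))

power-of-index : ∀ m p c → ⌊ (+ m) ℤ.≟ (+ suc p) ℤ.+ ((+ c) ℤ.- (+ p)) ⌋ ≡ ⌊ m ≟ suc c ⌋
power-of-index m p c =
  trans (cong (λ z → ⌊ (+ m) ℤ.≟ z ⌋) (order-plus-index (+ p) (+ c))) (⌊⌋-⇔ _ _ ℤP.+-injective (cong (λ z → + z)))
  where
  order-plus-index : ∀ (P C : ℤ) → (+ 1 ℤ.+ P) ℤ.+ (C ℤ.- P) ≡ + 1 ℤ.+ C
  order-plus-index = ℤSolver.solve-∀

≤?-⊓ : ∀ i a b → ⌊ i ≤? a ⌋ ∧ ⌊ i ≤? b ⌋ ≡ ⌊ i ≤? a ⊓ b ⌋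
≤?-⊓ i a b with i ≤? a | i ≤? b | i ≤? a ⊓ b
... | yes x | yes y | yes z = refl
... | yes x | yes y | no z = ⊥-elim (z (ℕP.⊓-glb x y))
... | yes x | no y | yes z = ⊥-elim (y (ℕP.≤-trans z (ℕP.m⊓n≤n a b)))
... | yes x | no y | no z = refl
... | no x | _ | yes z = ⊥-elim (x (ℕP.≤-trans z (ℕP.m⊓n≤m a b)))
... | no x | _ | no z = refl

alliance-with-centre : ∀ p (X : Vec Bool p) k → isDefAlliance (Star p) (true ∷ X) k ≡
  ⌊ (+ trues (Vec.map not X)) ℤ.+ k ℤ.≤? + trues X ⌋ ∧ (not (positive (trues X)) ∨ ⌊ (+ 0) ℤ.+ k ℤ.≤? + 1 ⌋)
alliance-with-centre p X k = cong₂ _∧_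
  (cong₂ (λ a b → ⌊ (+ a) ℤ.+ k ℤ.≤? + b ⌋) (δ-centre p false (Vec.map not X)) (δ-centre p true X))
  (trans (allL-tabulate p suc (λ i → i) _ (λ i → not (lookup X i) ∨ ⌊ (+ 0) ℤ.+ k ℤ.≤? + 1 ⌋)
           (λ i → cong (not (lookup X i) ∨_)
              (cong₂ (λ a b → ⌊ (+ a) ℤ.+ k ℤ.≤? + b ⌋) (δ-leaf p false (Vec.map not X) i) (δ-leaf p true X i))))
         (allL-members X _))

alliance-without-centre : ∀ p (X : Vec Bool p) k → isDefAlliance (Star p) (false ∷ X) k ≡
  not (positive (trues X)) ∨ ⌊ (+ 1) ℤ.+ k ℤ.≤? + 0 ⌋
alliance-without-centre p X k =
  trans (allL-tabulate p suc (λ i → i) _ (λ i → not (lookup X i) ∨ ⌊ (+ 1) ℤ.+ k ℤ.≤? + 0 ⌋)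
           (λ i → cong (not (lookup X i) ∨_)
              (cong₂ (λ a b → ⌊ (+ a) ℤ.+ k ℤ.≤? + b ⌋) (δ-leaf p true (Vec.map not X) i) (δ-leaf p false X i))))
         (allL-members X _)

alliance-with-centre-threshold : ∀ p (X : Vec Bool p) i →
  isDefAlliance (Star p) (true ∷ X) ((+ i) ℤ.- (+ p)) ≡ ⌊ i ≤? (trues X + trues X) ⊓ suc p ⌋
alliance-with-centre-threshold p X i = begin
    isDefAlliance (Star p) (true ∷ X) ((+ i) ℤ.- (+ p))
  ≡⟨ alliance-with-centre p X ((+ i) ℤ.- (+ p)) ⟩
    ⌊ (+ j') ℤ.+ ((+ i) ℤ.- (+ p)) ℤ.≤? + j ⌋ ∧ (not (positive j) ∨ ⌊ (+ 0) ℤ.+ ((+ i) ℤ.- (+ p)) ℤ.≤? + 1 ⌋)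
  ≡⟨ cong₂ (λ a b → a ∧ (not (positive j) ∨ b)) (shifted-≤ j' i p j) (shifted-≤ 0 i p 1) ⟩
    ⌊ j' + i ≤? j + p ⌋ ∧ (not (positive j) ∨ ⌊ i ≤? suc p ⌋)
  ≡⟨ cong (λ a → a ∧ (not (positive j) ∨ ⌊ i ≤? suc p ⌋)) (centre-bound (trues-compl X)) ⟩
    ⌊ i ≤? j + j ⌋ ∧ (not (positive j) ∨ ⌊ i ≤? suc p ⌋)
  ≡⟨ leaf-bound j ⟩
    ⌊ i ≤? (j + j) ⊓ suc p ⌋ ∎
  where
  open ≡-Reasoning
  j = trues X
  j' = trues (Vec.map not X)
  centre-bound : j' + j ≡ p → ⌊ j' + i ≤? j + p ⌋ ≡ ⌊ i ≤? j + j ⌋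
  centre-bound j'+j≡p = ⌊⌋-⇔ _ _ (ℕP.+-cancelˡ-≤ j' i (j + j) ∘ subst (j' + i ≤_) eq)
                                  (subst (j' + i ≤_) (sym eq) ∘ ℕP.+-monoʳ-≤ j')
    where
    eq : j + p ≡ j' + (j + j)
    eq = trans (cong (λ z → j + z) (sym j'+j≡p)) (rearrange j j')
      where
      rearrange : ∀ a b → a + (b + a) ≡ b + (a + a)
      rearrange = ℕSolver.solve-∀
  leaf-bound : ∀ j → ⌊ i ≤? j + j ⌋ ∧ (not (positive j) ∨ ⌊ i ≤? suc p ⌋) ≡ ⌊ i ≤? (j + j) ⊓ suc p ⌋
  leaf-bound zero = ∧-identityʳ _
  leaf-bound (suc j) = ≤?-⊓ i (suc j + suc j) (suc p)

alliance-one-leaf-threshold : ∀ q (X : Vec Bool (suc q)) → trues X ≡ 1 → ∀ i →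
  isDefAlliance (Star (suc q)) (false ∷ X) ((+ i) ℤ.- (+ suc q)) ≡ ⌊ i ≤? q ⌋
alliance-one-leaf-threshold q X one-leaf i =
  trans (alliance-without-centre (suc q) X ((+ i) ℤ.- (+ suc q)))
    (trans (cong (λ j → not (positive j) ∨ ⌊ (+ 1) ℤ.+ ((+ i) ℤ.- (+ suc q)) ℤ.≤? + 0 ⌋) one-leaf)
      (trans (shifted-≤ 1 i (suc q) 0) (⌊⌋-⇔ _ _ ℕP.≤-pred s≤s)))

exactIndex-with-centre : ∀ q (X : Vec Bool (suc q)) →
  exactIndex (Star (suc q)) (true ∷ X) ≡ (+ ((trues X + trues X) ⊓ suc (suc q))) ℤ.- (+ suc q)
exactIndex-with-centre q X =
  exactIndex-threshold (Star p) (true ∷ X) p _ (maxDegree-Star p (s≤s z≤n)) c≤2p (alliance-with-centre-threshold p X)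
  where
  p = suc q
  c≤2p : (trues X + trues X) ⊓ suc p ≤ 2 * p
  c≤2p = ℕP.≤-trans (ℕP.m⊓n≤n _ (suc p))
           (s≤s (ℕP.≤-trans (s≤s (ℕP.m≤m+n q 0)) (ℕP.m≤n+m (suc (q + 0)) q)))

exactIndex-one-leaf : ∀ q (X : Vec Bool (suc q)) → trues X ≡ 1 →
  exactIndex (Star (suc q)) (false ∷ X) ≡ (+ q) ℤ.- (+ suc q)
exactIndex-one-leaf q X one-leaf =
  exactIndex-threshold (Star (suc q)) (false ∷ X) (suc q) q (maxDegree-Star (suc q) (s≤s z≤n))
    (ℕP.≤-trans (ℕP.n≤1+n q) (ℕP.m≤m+n (suc q) _)) (alliance-one-leaf-threshold q X one-leaf)

singleton : ∀ {n} → Fin n → VSet n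
singleton v = Vec.tabulate (λ u → ⌊ u Fin.≟ v ⌋)

singleton-lookup : ∀ {n} (v u : Fin n) → lookup (singleton v) u ≡ ⌊ u Fin.≟ v ⌋
singleton-lookup v u = VecP.lookup∘tabulate _ u

singleton-self : ∀ {n} (v : Fin n) → lookup (singleton v) v ≡ true
singleton-self v = trans (singleton-lookup v v) (trans (isYes≗does (v Fin.≟ v)) (dec-true (v Fin.≟ v) refl))

module _ (Γ : SimpleGraph) where
  open SimpleGraph Γ

  reachStep : VSet order → VSet order → VSet order
  reachStep S R = Vec.tabulate (λ u → lookup R u ∨ (lookup S u ∧ anyL (λ w → lookup R w ∧ adj w u) (V Γ)))

  reachStep-lookup : ∀ S R u →
    lookup (reachStep S R) u ≡ (lookup R u ∨ (lookup S u ∧ anyL (λ w → lookup R w ∧ adj w u) (V Γ)))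
  reachStep-lookup S R u = VecP.lookup∘tabulate _ u

  reachFrom-iter : ∀ S v → reachFrom Γ S v ≡ iter order (reachStep S) (singleton v)
  reachFrom-iter S v = refl

  reachStep-stable : ∀ S → reachStep S S ≡ S
  reachStep-stable S = lookup-ext _ _ (λ u → trans (reachStep-lookup S S u) (absorb (lookup S u) _))
    where
    absorb : ∀ b x → b ∨ (b ∧ x) ≡ b
    absorb true x = refl
    absorb false x = refl

  connected-if-spanning : ∀ S → (∀ v → lookup S v ≡ true → reachFrom Γ S v ≡ S) → connected Γ S ≡ true
  connected-if-spanning S spans = allL-true _ at (V Γ)
    where
    excluded-middle : ∀ b → not b ∨ b ≡ true
    excluded-middle true = refl
    excluded-middle false = refl
    at : ∀ v → not (lookup S v) ∨ allL (λ u → not (lookup S u) ∨ lookup (reachFrom Γ S v) u) (V Γ) ≡ true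
    at v with lookup S v in v∈S
    ... | false = refl
    ... | true = trans (cong (λ R → allL (λ u → not (lookup S u) ∨ lookup R u) (V Γ)) (spans v v∈S))
                       (allL-true _ (λ u → excluded-middle (lookup S u)) (V Γ))

reach-from-centre : ∀ p (X : Vec Bool p) → reachStep (Star p) (true ∷ X) (singleton zero) ≡ true ∷ X
reach-from-centre p X = lookup-ext _ _ at
  where
  at : ∀ u → lookup (reachStep (Star p) (true ∷ X) (singleton zero)) u ≡ lookup (true ∷ X) u
  at zero = refl
  at (suc u) = trans (reachStep-lookup (Star p) (true ∷ X) (singleton zero) (suc u))
                     (cong₂ _∨_ (singleton-lookup zero (suc u)) (∧-identityʳ (lookup X u)))

-- ... and two steps from a leaf of S: first the centre, then the other leaves.
reach-from-leaf : ∀ p (X : Vec Bool p) i → lookup X i ≡ true →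
  reachStep (Star p) (true ∷ X) (reachStep (Star p) (true ∷ X) (singleton (suc i))) ≡ true ∷ X
reach-from-leaf p X i i∈X = lookup-ext _ _ at
  where
  S = true ∷ X
  R₁ = reachStep (Star p) S (singleton (suc i))
  centre∈R₁ : lookup R₁ zero ≡ true
  centre∈R₁ = anyL-tabulate-witness p suc _ i (trans (∧-identityʳ _) (singleton-self (suc i)))
  R₁⊆S : ∀ u → lookup X u ≡ false → lookup R₁ (suc u) ≡ false
  R₁⊆S u u∉X =
    trans (reachStep-lookup (Star p) S (singleton (suc i)) (suc u))
      (trans (cong₂ (λ a b → a ∨ (b ∧ anyL (λ w → lookup (singleton (suc i)) w ∧ SimpleGraph.adj (Star p) w (suc u))
                                            (V (Star p))))
                    (singleton-lookup (suc i) (suc u)) u∉X)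
        (trans (∨-identityʳ _) (not-i (suc u Fin.≟ suc i))))
    where
    not-i : (d : Dec (suc u ≡ suc i)) → ⌊ d ⌋ ≡ false
    not-i (yes u≡i) with () ← trans (sym u∉X) (subst (λ z → lookup X z ≡ true) (sym (FinP.suc-injective u≡i)) i∈X)
    not-i (no _) = refl
  absorb-into : ∀ a b → (b ≡ false → a ≡ false) → a ∨ b ≡ b
  absorb-into a true _ = ∨-zeroʳ a
  absorb-into a false k = trans (∨-identityʳ a) (k refl)
  at : ∀ u → lookup (reachStep (Star p) S R₁) u ≡ lookup S u
  at zero = cong (λ z → z ∨ (true ∧ anyL (λ w → lookup R₁ w ∧ SimpleGraph.adj (Star p) w zero) (V (Star p)))) centre∈R₁
  at (suc u) = trans (reachStep-lookup (Star p) S R₁ (suc u))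
     (trans (cong (λ z → lookup R₁ (suc u) ∨ (lookup X u ∧ ((z ∧ true)
                           ∨ anyL (λ w → lookup R₁ w ∧ SimpleGraph.adj (Star p) w (suc u)) (List.tabulate suc))))
                  centre∈R₁)
       (trans (cong (λ z → lookup R₁ (suc u) ∨ z) (∧-identityʳ (lookup X u)))
         (absorb-into _ _ (R₁⊆S u))))

-- A set containing the centre induces a connected subgraph (p ≥ 1, so the
-- closure runs for at least two steps).
connected-with-centre : ∀ q (X : Vec Bool (suc q)) → connected (Star (suc q)) (true ∷ X) ≡ true
connected-with-centre q X = connected-if-spanning (Star p) S spans
  where
  p = suc q
  S = true ∷ X
  spans : ∀ v → lookup S v ≡ true → reachFrom (Star p) S v ≡ S
  spans zero _ = begin
      reachFrom (Star p) S zero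
    ≡⟨ reachFrom-iter (Star p) S zero ⟩
      iter (suc p) (reachStep (Star p) S) (singleton zero)
    ≡⟨ iter-suc p (reachStep (Star p) S) (singleton zero) ⟩
      iter p (reachStep (Star p) S) (reachStep (Star p) S (singleton zero))
    ≡⟨ cong (iter p (reachStep (Star p) S)) (reach-from-centre p X) ⟩
      iter p (reachStep (Star p) S) S
    ≡⟨ iter-fixed p (reachStep (Star p) S) S (reachStep-stable (Star p) S) ⟩
      S ∎
    where open ≡-Reasoning
  spans (suc i) i∈X = begin
      reachFrom (Star p) S (suc i)
    ≡⟨ reachFrom-iter (Star p) S (suc i) ⟩
      iter (suc p) (reachStep (Star p) S) (singleton (suc i))
    ≡⟨ iter-suc p (reachStep (Star p) S) (singleton (suc i)) ⟩
      iter p (reachStep (Star p) S) (reachStep (Star p) S (singleton (suc i)))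
    ≡⟨ iter-suc q (reachStep (Star p) S) _ ⟩
      iter q (reachStep (Star p) S) (reachStep (Star p) S (reachStep (Star p) S (singleton (suc i))))
    ≡⟨ cong (iter q (reachStep (Star p) S)) (reach-from-leaf p X i i∈X) ⟩
      iter q (reachStep (Star p) S) S
    ≡⟨ iter-fixed q (reachStep (Star p) S) S (reachStep-stable (Star p) S) ⟩
      S ∎
    where open ≡-Reasoning

leaf-isolated : ∀ p (X : Vec Bool p) i → reachStep (Star p) (false ∷ X) (singleton (suc i)) ≡ singleton (suc i)
leaf-isolated p X i = lookup-ext _ _ at
  where
  at : ∀ u → lookup (reachStep (Star p) (false ∷ X) (singleton (suc i))) u ≡ lookup (singleton (suc i)) u
  at zero = refl
  at (suc u) = trans (reachStep-lookup (Star p) (false ∷ X) (singleton (suc i)) (suc u))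
    (trans (cong (λ z → lookup (singleton (suc i)) (suc u) ∨ (lookup X u ∧ z))
                 (anyL-tabulate-false p suc (λ w → lookup (singleton (suc i)) w ∧ SimpleGraph.adj (Star p) w (suc u))
                                      (λ w → ∧-zeroʳ _)))
      (trans (cong (λ z → lookup (singleton (suc i)) (suc u) ∨ z) (∧-zeroʳ (lookup X u))) (∨-identityʳ _)))

atMostOne : ℕ → Bool
atMostOne (suc (suc _)) = false
atMostOne _ = true

allMembersEqual : ∀ {p} → Vec Bool p → Bool
allMembersEqual {p} X =
  allL (λ i → not (lookup X i) ∨ allL (λ u → not (lookup X u) ∨ ⌊ u Fin.≟ i ⌋) (allFin p)) (allFin p)

allMembersEqual-trues : ∀ {p} (X : Vec Bool p) → allMembersEqual X ≡ atMostOne (trues X)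
allMembersEqual-trues [] = refl
allMembersEqual-trues {suc p} (true ∷ X) =
  trans (cong₂ _∧_ (no-other-member _ (λ u → refl)) (no-other-member _ (λ u → refl))) (both (trues X))
  where
  -- a member of X, i.e. a vertex suc u, would differ from 0
  no-other-member : (r : Fin (suc p) → Bool) → (∀ u → r (suc u) ≡ not (lookup X u) ∨ false) →
    allL r (List.tabulate {n = p} suc) ≡ not (positive (trues X)) ∨ false
  no-other-member r h = trans (allL-tabulate p suc (λ u → u) r _ h) (allL-members X false)
  both : ∀ j → (not (positive j) ∨ false) ∧ (not (positive j) ∨ false) ≡ atMostOne (suc j)
  both zero = refl
  both (suc j) = refl
allMembersEqual-trues {suc p} (false ∷ X) =
  trans (allL-tabulate p suc (λ i → i) _
           (λ i → not (lookup X i) ∨ allL (λ u → not (lookup X u) ∨ ⌊ u Fin.≟ i ⌋) (allFin p))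
           (λ i → cong (not (lookup X i) ∨_) (shift-down i)))
        (allMembersEqual-trues X)
  where
  shift-down : ∀ i → allL (λ u → not (lookup (false ∷ X) u) ∨ ⌊ u Fin.≟ suc i ⌋) (allFin (suc p))
                   ≡ allL (λ u → not (lookup X u) ∨ ⌊ u Fin.≟ i ⌋) (allFin p)
  shift-down i = allL-tabulate p suc (λ u → u) _ _
    (λ u → cong (not (lookup X u) ∨_) (⌊⌋-⇔ _ _ FinP.suc-injective (cong suc)))

connected-without-centre : ∀ p (X : Vec Bool p) → connected (Star p) (false ∷ X) ≡ atMostOne (trues X)
connected-without-centre p X =
  trans (allL-tabulate p suc (λ i → i) _
           (λ i → not (lookup X i) ∨ allL (λ u → not (lookup X u) ∨ ⌊ u Fin.≟ i ⌋) (allFin p)) at)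
        (allMembersEqual-trues X)
  where
  S = false ∷ X
  at : ∀ i → (not (lookup S (suc i)) ∨ allL (λ u → not (lookup S u) ∨ lookup (reachFrom (Star p) S (suc i)) u) (V (Star p)))
           ≡ (not (lookup X i) ∨ allL (λ u → not (lookup X u) ∨ ⌊ u Fin.≟ i ⌋) (allFin p))
  at i = cong (not (lookup X i) ∨_)
    (trans (cong (λ R → allL (λ u → not (lookup S u) ∨ lookup R u) (V (Star p)))
                 (iter-fixed (suc p) (reachStep (Star p) S) (singleton (suc i)) (leaf-isolated p X i)))
      (allL-tabulate p suc (λ u → u) _ _
         (λ u → cong (not (lookup X u) ∨_)
                     (trans (singleton-lookup (suc i) (suc u)) (⌊⌋-⇔ _ _ FinP.suc-injective (cong suc))))))

nonempty-without-centre : ∀ p (X : Vec Bool p) → nonempty (Star p) (false ∷ X) ≡ positive (trues X)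
nonempty-without-centre p X = trans (anyL-tabulate p suc (λ i → i) _ (lookup X) (λ i → refl)) (anyL-lookup X)

isOne : ℕ → Bool
isOne (suc zero) = true
isOne _ = false

contributes : ∀ p → ℕ → VSet (suc p) → Bool
contributes p m S =
  nonempty (Star p) S ∧ connected (Star p) S ∧ ⌊ (+ m) ℤ.≟ (+ suc p) ℤ.+ exactIndex (Star p) S ⌋

contributes-with-centre : ∀ q (X : Vec Bool (suc q)) m →
  contributes (suc q) m (true ∷ X) ≡ ⌊ m ≟ suc ((trues X + trues X) ⊓ suc (suc q)) ⌋
contributes-with-centre q X m = cong₂ _∧_ (connected-with-centre q X)
  (trans (cong (λ k → ⌊ (+ m) ℤ.≟ (+ suc (suc q)) ℤ.+ k ⌋) (exactIndex-with-centre q X))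
         (power-of-index m (suc q) _))

contributes-without-centre : ∀ q (X : Vec Bool (suc q)) m →
  contributes (suc q) m (false ∷ X) ≡ ⌊ m ≟ suc q ⌋ ∧ isOne (trues X)
contributes-without-centre q X m =
  trans (cong₂ (λ a b → a ∧ b ∧ power) (nonempty-without-centre p X) (connected-without-centre p X))
        (by-size (trues X) refl)
  where
  p = suc q
  power = ⌊ (+ m) ℤ.≟ (+ suc p) ℤ.+ exactIndex (Star p) (false ∷ X) ⌋
  by-size : ∀ j → trues X ≡ j → positive j ∧ atMostOne j ∧ power ≡ ⌊ m ≟ suc q ⌋ ∧ isOne j
  by-size zero _ = sym (∧-zeroʳ _)
  by-size (suc (suc j)) _ = sym (∧-zeroʳ _)
  by-size (suc zero) one-leaf =
    trans (cong (λ k → ⌊ (+ m) ℤ.≟ (+ suc p) ℤ.+ k ⌋) (exactIndex-one-leaf q X one-leaf))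
          (trans (power-of-index m p q) (sym (∧-identityʳ _)))

count-allSubsets-suc : ∀ p (r : VSet (suc p) → Bool) → count r (allSubsets (suc p)) ≡
  count (r ∘ (true ∷_)) (allSubsets p) + count (r ∘ (false ∷_)) (allSubsets p)
count-allSubsets-suc p r =
  trans (count-++ r (List.map (true ∷_) (allSubsets p)) (List.map (false ∷_) (allSubsets p)))
        (cong₂ _+_ (count-map r (true ∷_) (allSubsets p)) (count-map r (false ∷_) (allSubsets p)))

-- [ b ]· c is c when b holds and 0 otherwise; it is how c ·x^ e reads at x^m.
infix 7 [_]·_
[_]·_ : Bool → ℕ → ℕ
[ b ]· c = if b then c else 0

[]·-+ : ∀ b x y → [ b ]· (x + y) ≡ [ b ]· x + [ b ]· y
[]·-+ true x y = refl
[]·-+ false x y = refl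

sumN : ℕ → (ℕ → ℕ) → ℕ
sumN zero f = 0
sumN (suc n) f = f 0 + sumN n (f ∘ suc)

sumN-cong : ∀ n (f g : ℕ → ℕ) → (∀ i → i < n → f i ≡ g i) → sumN n f ≡ sumN n g
sumN-cong zero f g h = refl
sumN-cong (suc n) f g h = cong₂ _+_ (h 0 (s≤s z≤n)) (sumN-cong n (f ∘ suc) (g ∘ suc) (λ i i<n → h (suc i) (s≤s i<n)))

sumN-zero : ∀ n (f : ℕ → ℕ) → (∀ i → f i ≡ 0) → sumN n f ≡ 0
sumN-zero zero f h = refl
sumN-zero (suc n) f h = cong₂ _+_ (h 0) (sumN-zero n (f ∘ suc) (h ∘ suc))

sumN-+ : ∀ n (f g : ℕ → ℕ) → sumN n (λ i → f i + g i) ≡ sumN n f + sumN n g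
sumN-+ zero f g = refl
sumN-+ (suc n) f g = trans (cong (λ z → f 0 + g 0 + z) (sumN-+ n (f ∘ suc) (g ∘ suc))) (interchange (f 0) (g 0) _ _)
  where
  interchange : ∀ a b c d → a + b + (c + d) ≡ a + c + (b + d)
  interchange = ℕSolver.solve-∀

sumN-snoc : ∀ n (f : ℕ → ℕ) → sumN (suc n) f ≡ sumN n f + f n
sumN-snoc zero f = ℕP.+-comm (f 0) 0
sumN-snoc (suc n) f = trans (cong (λ z → f 0 + z) (sumN-snoc n (f ∘ suc))) (sym (ℕP.+-assoc (f 0) _ _))

sumN-split : ∀ a b (f : ℕ → ℕ) → sumN (a + b) f ≡ sumN a f + sumN b (λ i → f (a + i))
sumN-split zero b f = refl
sumN-split (suc a) b f = trans (cong (λ z → f 0 + z) (sumN-split a b (f ∘ suc))) (sym (ℕP.+-assoc (f 0) _ _))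

sumN-[]· : ∀ n b (g : ℕ → ℕ) → sumN n (λ i → [ b ]· g i) ≡ [ b ]· sumN n g
sumN-[]· n true g = refl
sumN-[]· n false g = sumN-zero n _ (λ i → refl)

-- Counting subsets of Fin p by a property of their size: C(p, j) have size j.
-- Induction on p with Pascal's rule C(p+1, j+1) = C(p, j) + C(p, j+1).
count-by-size : ∀ p (h : ℕ → Bool) → count (h ∘ trues) (allSubsets p) ≡ sumN (suc p) (λ j → [ h j ]· (p C j))
count-by-size zero h with h 0
... | true = refl
... | false = refl
count-by-size (suc p) h = begin
    count (h ∘ trues) (allSubsets (suc p))
  ≡⟨ count-allSubsets-suc p (h ∘ trues) ⟩
    count (h ∘ suc ∘ trues) (allSubsets p) + count (h ∘ trues) (allSubsets p)
  ≡⟨ cong₂ _+_ (count-by-size p (h ∘ suc)) (count-by-size p h) ⟩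
    sumN (suc p) with-0 + ([ h 0 ]· 1 + sumN p without-0)
  ≡⟨ cong (λ z → sumN (suc p) with-0 + ([ h 0 ]· 1 + z)) (sym last-term-vanishes) ⟩
    sumN (suc p) with-0 + ([ h 0 ]· 1 + (sumN p without-0 + without-0 p))
  ≡⟨ cong (λ z → sumN (suc p) with-0 + ([ h 0 ]· 1 + z)) (sym (sumN-snoc p without-0)) ⟩
    sumN (suc p) with-0 + ([ h 0 ]· 1 + sumN (suc p) without-0)
  ≡⟨ regroup ([ h 0 ]· 1) (sumN (suc p) with-0) (sumN (suc p) without-0) ⟩
    [ h 0 ]· 1 + (sumN (suc p) with-0 + sumN (suc p) without-0)
  ≡⟨ cong (λ z → [ h 0 ]· 1 + z) (sym (sumN-+ (suc p) with-0 without-0)) ⟩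
    [ h 0 ]· 1 + sumN (suc p) (λ j → with-0 j + without-0 j)
  ≡⟨ cong (λ z → [ h 0 ]· 1 + z) (sumN-cong (suc p) _ _ (λ j _ → pascal j)) ⟩
    sumN (suc (suc p)) (λ j → [ h j ]· (suc p C j)) ∎
  where
  open ≡-Reasoning
  -- sizes j + 1 of sets containing 0, resp. not containing it
  with-0 without-0 : ℕ → ℕ
  with-0 j = [ h (suc j) ]· (p C j)
  without-0 j = [ h (suc j) ]· (p C suc j)
  last-term-vanishes : sumN p without-0 + without-0 p ≡ sumN p without-0
  last-term-vanishes rewrite k>n⇒nCk≡0 (ℕP.n<1+n p) with h (suc p)
  ... | true = ℕP.+-identityʳ _
  ... | false = ℕP.+-identityʳ _
  pascal : ∀ j → with-0 j + without-0 j ≡ [ h (suc j) ]· (suc p C suc j)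
  pascal j = trans (sym ([]·-+ (h (suc j)) _ _)) (cong ([ h (suc j) ]·_) (nCk+nC[k+1]≡[n+1]C[k+1] p j))
  regroup : ∀ a t u → t + (a + u) ≡ a + (t + u)
  regroup = ℕSolver.solve-∀

singletons : ∀ p b → sumN (suc p) (λ j → [ b ∧ isOne j ]· (p C j)) ≡ [ b ]· p
singletons p false = sumN-zero (suc p) _ (λ j → refl)
singletons zero true = refl
singletons (suc p) true =
  trans (cong₂ _+_ (nC1≡n (suc p)) (sumN-zero p _ (λ j → refl))) (ℕP.+-identityʳ (suc p))

foldr-applyUpTo : ∀ k (e φ : ℕ → ℕ) → foldr (λ i s → φ i + s) 0 (applyUpTo e k) ≡ sumN k (φ ∘ e)
foldr-applyUpTo zero e φ = refl
foldr-applyUpTo (suc k) e φ = cong (λ z → φ (e 0) + z) (foldr-applyUpTo k (e ∘ suc) φ)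

foldr-⊕-at : ∀ (xs : List ℕ) (F : ℕ → Poly) m → foldr (λ i p → F i ⊕ p) zeroP xs m ≡ foldr (λ i s → F i m + s) 0 xs
foldr-⊕-at [] F m = refl
foldr-⊕-at (x ∷ xs) F m = cong (λ z → F x m + z) (foldr-⊕-at xs F m)

ΣP-sumN : ∀ a b f m → (ΣP[ a to b ] f) m ≡ sumN (suc b ∸ a) (λ i → f (a + i) m)
ΣP-sumN a b f m = trans (foldr-⊕-at (upTo (suc b ∸ a)) (λ i → f (a + i)) m)
                        (foldr-applyUpTo (suc b ∸ a) (λ i → i) (λ i → f (a + i) m))

Σ-sumN : ∀ a b g → Σ[ a to b ] g ≡ sumN (suc b ∸ a) (λ i → g (a + i))
Σ-sumN a b g = foldr-applyUpTo (suc b ∸ a) (λ i → i) (λ i → g (a + i))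

lower-half : ∀ p j → j ≤ p / 2 → j + j ≤ p
lower-half p j j≤p/2 =
  ℕP.≤-trans (ℕP.+-mono-≤ j≤p/2 j≤p/2) (ℕP.≤-trans (ℕP.≤-reflexive (double (p / 2))) (DivMod.m/n*n≤m p 2))
  where
  double : ∀ h → h + h ≡ h * 2
  double = ℕSolver.solve-∀

upper-half : ∀ p k → suc (p / 2) ≤ k → suc p ≤ k + k
upper-half p k p/2<k = begin
    suc p
  ≡⟨ cong suc (DivMod.m≡m%n+[m/n]*n p 2) ⟩
    suc (p % 2 + p / 2 * 2)
  ≤⟨ s≤s (ℕP.+-monoˡ-≤ (p / 2 * 2) (ℕP.≤-pred (DivMod.m%n<n p 2))) ⟩
    suc (1 + p / 2 * 2)
  ≡⟨ double-suc (p / 2) ⟩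
    suc (p / 2) + suc (p / 2)
  ≤⟨ ℕP.+-mono-≤ p/2<k p/2<k ⟩
    k + k ∎
  where
  open ℕP.≤-Reasoning
  double-suc : ∀ h → suc (1 + h * 2) ≡ suc h + suc h
  double-suc = ℕSolver.solve-∀

-- ⌈n/2⌉ = ⌊(n + 1)/2⌋ = ⌊p/2⌋ + 1 for n = p + 1.
ceil-half : ∀ p → (suc p + 1) / 2 ≡ suc (p / 2)
ceil-half p = trans (cong (_/ 2) (ℕP.+-comm (suc p) 1)) (DivMod.m/n≡1+[m∸n]/n {suc (suc p)} {2} (s≤s (s≤s z≤n)))

split-at-half : ∀ p m →
  sumN (suc p) (λ j → [ ⌊ m ≟ suc ((j + j) ⊓ suc p) ⌋ ]· (p C j)) ≡
  (ΣP[ 0 to p / 2 ] (λ k → (p C k) ·x^ (2 * k + 1))) m + [ ⌊ m ≟ suc p + 1 ⌋ ]· (Σ[ (suc p + 1) / 2 to p ] (λ k → p C k))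
split-at-half p m = begin
    sumN (suc p) f
  ≡⟨ cong (λ z → sumN z f) (sym (ℕP.m+[n∸m]≡n a≤1+p)) ⟩
    sumN (a + (suc p ∸ a)) f
  ≡⟨ sumN-split a (suc p ∸ a) f ⟩
    sumN a f + sumN (suc p ∸ a) (λ i → f (a + i))
  ≡⟨ cong₂ _+_ small-j large-j ⟩
    sumN a (λ k → [ ⌊ m ≟ 2 * k + 1 ⌋ ]· (p C k)) + [ ⌊ m ≟ suc p + 1 ⌋ ]· sumN (suc p ∸ a) (λ i → p C (a + i))
  ≡⟨ cong₂ (λ x y → x + [ ⌊ m ≟ suc p + 1 ⌋ ]· y) (sym (ΣP-sumN 0 (p / 2) _ m)) (sym upper-range) ⟩
    (ΣP[ 0 to p / 2 ] (λ k → (p C k) ·x^ (2 * k + 1))) m + [ ⌊ m ≟ suc p + 1 ⌋ ]· (Σ[ (suc p + 1) / 2 to p ] (λ k → p C k)) ∎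
  where
  open ≡-Reasoning
  a = suc (p / 2)
  f : ℕ → ℕ
  f j = [ ⌊ m ≟ suc ((j + j) ⊓ suc p) ⌋ ]· (p C j)
  a≤1+p : a ≤ suc p
  a≤1+p = s≤s (DivMod.m/n≤m p 2)
  odd : ∀ j → suc (j + j) ≡ 2 * j + 1
  odd = ℕSolver.solve-∀
  small-j : sumN a f ≡ sumN a (λ k → [ ⌊ m ≟ 2 * k + 1 ⌋ ]· (p C k))
  small-j = sumN-cong a _ _ (λ j j<a → cong (λ e → [ ⌊ m ≟ e ⌋ ]· (p C j))
              (trans (cong suc (ℕP.m≤n⇒m⊓n≡m (ℕP.m≤n⇒m≤1+n (lower-half p j (ℕP.≤-pred j<a))))) (odd j)))
  large-j : sumN (suc p ∸ a) (λ i → f (a + i)) ≡ [ ⌊ m ≟ suc p + 1 ⌋ ]· sumN (suc p ∸ a) (λ i → p C (a + i))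
  large-j = trans (sumN-cong (suc p ∸ a) _ (λ i → [ ⌊ m ≟ suc p + 1 ⌋ ]· (p C (a + i)))
                    (λ i _ → cong (λ e → [ ⌊ m ≟ e ⌋ ]· (p C (a + i)))
                      (trans (cong suc (ℕP.m≥n⇒m⊓n≡n (upper-half p (a + i) (ℕP.m≤m+n a i))))
                             (ℕP.+-comm 1 (suc p)))))
                  (sumN-[]· (suc p ∸ a) _ _)
  upper-range : Σ[ (suc p + 1) / 2 to p ] (λ k → p C k) ≡ sumN (suc p ∸ a) (λ i → p C (a + i))
  upper-range = trans (Σ-sumN ((suc p + 1) / 2) p (λ k → p C k))
                      (cong (λ z → sumN (suc p ∸ z) (λ i → p C (z + i))) (ceil-half p))

A-star : ∀ p → 1 ≤ p → ∀ m →
  A (Star p) m ≡ sumN (suc p) (λ j → [ ⌊ m ≟ suc ((j + j) ⊓ suc p) ⌋ ]· (p C j)) + [ ⌊ m ≟ p ⌋ ]· p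
A-star (suc q) _ m = begin
    A (Star p) m
  ≡⟨ count-allSubsets-suc p (contributes p m) ⟩
    count (contributes p m ∘ (true ∷_)) (allSubsets p) + count (contributes p m ∘ (false ∷_)) (allSubsets p)
  ≡⟨ cong₂ _+_ (count-cong (λ X → contributes-with-centre q X m) (allSubsets p))
               (count-cong (λ X → contributes-without-centre q X m) (allSubsets p)) ⟩
    count (with-centre ∘ trues) (allSubsets p) + count (single-leaf ∘ trues) (allSubsets p)
  ≡⟨ cong₂ _+_ (count-by-size p with-centre) (count-by-size p single-leaf) ⟩
    sumN (suc p) (λ j → [ with-centre j ]· (p C j)) + sumN (suc p) (λ j → [ single-leaf j ]· (p C j))
  ≡⟨ cong (λ z → sumN (suc p) (λ j → [ with-centre j ]· (p C j)) + z) (singletons p ⌊ m ≟ p ⌋) ⟩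
    sumN (suc p) (λ j → [ with-centre j ]· (p C j)) + [ ⌊ m ≟ p ⌋ ]· p ∎
  where
  open ≡-Reasoning
  p = suc q
  with-centre single-leaf : ℕ → Bool
  with-centre j = ⌊ m ≟ suc ((j + j) ⊓ suc p) ⌋
  single-leaf j = ⌊ m ≟ p ⌋ ∧ isOne j

corollary3p14 : (n : ℕ) → 2 ≤ n →
    A (star n) ≈ₚ
    ΣP[ 0 to (n ∸ 1) / 2 ] (λ k → ((n ∸ 1) C k) ·x^ (2 * k + 1))
    ⊕ (n ∸ 1) ·x^ (n ∸ 1)
    ⊕ (Σ[ (n + 1) / 2 to n ∸ 1 ] (λ k → (n ∸ 1) C k)) ·x^ (n + 1)
corollary3p14 (suc p) (s≤s 1≤p) m = begin
    A (Star p) m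
  ≡⟨ A-star p 1≤p m ⟩
    sumN (suc p) (λ j → [ ⌊ m ≟ suc ((j + j) ⊓ suc p) ⌋ ]· (p C j)) + middle
  ≡⟨ cong (_+ middle) (split-at-half p m) ⟩
    lower + upper + middle
  ≡⟨ swap lower upper middle ⟩
    lower + middle + upper ∎
  where
  open ≡-Reasoning
  lower = (ΣP[ 0 to p / 2 ] (λ k → (p C k) ·x^ (2 * k + 1))) m
  middle = [ ⌊ m ≟ p ⌋ ]· p
  upper = [ ⌊ m ≟ suc p + 1 ⌋ ]· (Σ[ (suc p + 1) / 2 to p ] (λ k → p C k))
  swap : ∀ x y z → x + y + z ≡ x + z + y
  swap = ℕSolver.solve-∀
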